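{- In every execution of Semi-Random Rounding, the output $\lambda'$ satisfies $\lambda'(S)=\lambda(S)$ for every $S\in\mathcal P$, and $c^{\mathsf T}\lambda'\le c^{\mathsf T}\lambda$.
   Context: Semi-Random Rounding takes as input a finite set $D$, a partition $\mathcal P$ of $D$, a vector $\lambda\in[0,1]^D$ with $\lambda(S):=\sum_{i\in S}\lambda_i\in\mathbb Z$ for all $S\in\mathcal P$, an integer $K\ge1$, and $c\in\mathbb R^D$. It first lets $\lambda^{(K)}$ be a vector minimizing $c^{\mathsf T}\lambda^{(K)}$ subject to $\lambda^{(K)}_i\in\{2^{ -K}\lfloor 2^K\lambda_i\rfloor,2^{ -K}\lceil2^K\lambda_i\rceil\}$ for all $i\in D$ and $\lambda^{(K)}(S)=\lambda(S)$ for all $S\in\mathcal P$. Then for $k=K-1$ down to $0$: let $S_k=\{i\in D:2^k\lambda^{(k+1)}_i\notin\mathbb Z\}$; choose an arbitrary perfect matching $M$ on $S_k$ in which matched indices lie in the same class of $\mathcal P$; set $\nu_i=0$ for $i\notin S_k$ and, independently for each $(i,j)\in M$, with probability $1/2$ set $(\nu_i,\nu_j)=(1/2,-1/2)$ and otherwise $(\nu_i,\nu_j)=(-1/2,1/2)$; choose $\nu'\in\{\nu,-\nu\}$ with $c^{\mathsf T}\nu'\le0$; set $\lambda^{(k)}=\lambda^{(k+1)}+\nu'/2^k$. The output is $\lambda'=\lambda^{(0)}\in\{0,1\}^D$. -}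

module Defs where

open import Level using (Level; _⊔_; suc)
open import Algebra.Bundles using (CommutativeRing)
open import Relation.Binary.Structures using (IsTotalOrder)
open import Data.Nat as ℕ using (ℕ; zero; _<_)
  renaming (suc to sucℕ)
open import Data.Integer as ℤ using (ℤ; +_; -[1+_])
open import Data.Fin using (Fin; _≟_)
  renaming (zero to fzero; suc to fsuc)
open import Data.Bool using (Bool; true; false; not)
open import Data.Product using (Σ; _×_; ∃; ∃-syntax; Σ-syntax)
open import Data.Sum using (_⊎_)
open import Relation.Nullary using (¬_; yes; no; Dec)
open import Relation.Binary.PropositionalEquality using (_≡_)

-- Agda's standard library has no reals, so we
-- state the result for an arbitrary (commutative) ordered ring that has
-- an element 1/2 and a floor function to ℤ.  ℝ is an instance, so the
-- statement below implies the paper's statement (it is a generalisation).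

module RingDefs {c ℓ : Level} (R : CommutativeRing c ℓ) where
  open CommutativeRing R

  fromℕ : ℕ → Carrier
  fromℕ zero     = 0#
  fromℕ (sucℕ n) = 1# + fromℕ n

  fromℤ : ℤ → Carrier
  fromℤ (+ n)      = fromℕ n
  fromℤ -[1+ n ]   = - fromℕ (sucℕ n)

  IsInteger : Carrier → Set ℓ
  IsInteger x = ∃[ z ] (x ≈ fromℤ z)

  two : Carrier
  two = 1# + 1#

  pow : Carrier → ℕ → Carrier
  pow x zero     = 1#
  pow x (sucℕ k) = x * pow x k

record IsOrderedFloorRing {c ℓ ℓ₂ : Level} (R : CommutativeRing c ℓ)
         (_≤_ : CommutativeRing.Carrier R → CommutativeRing.Carrier R → Set ℓ₂)
         : Set (c ⊔ ℓ ⊔ ℓ₂) where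
  open CommutativeRing R
  open RingDefs R
  field
    isTotalOrder : IsTotalOrder _≈_ _≤_
    +-monoˡ-≤    : ∀ {x y} z → x ≤ y → (x + z) ≤ (y + z)
    *-nonneg     : ∀ {x y} → 0# ≤ x → 0# ≤ y → 0# ≤ (x * y)
    half         : Carrier
    half+half    : (half + half) ≈ 1#
    ⌊_⌋          : Carrier → ℤ
    floor-≤      : ∀ x → fromℤ ⌊ x ⌋ ≤ x
    floor-<      : ∀ x → (x ≤ (fromℤ ⌊ x ⌋ + 1#)) × ¬ (x ≈ (fromℤ ⌊ x ⌋ + 1#))

record OrderedFloorRing (c ℓ ℓ₂ : Level) : Set (suc (c ⊔ ℓ ⊔ ℓ₂)) where
  field
    cring       : CommutativeRing c ℓ
    _≤_         : CommutativeRing.Carrier cring → CommutativeRing.Carrier cring → Set ℓ₂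
    isOFR       : IsOrderedFloorRing cring _≤_
  open CommutativeRing cring public
  open RingDefs cring public
  open IsOrderedFloorRing isOFR public

-- D = Fin n.  A partition 𝒫 of D into (at most) m classes is given by a
-- class map p : Fin n → Fin m; the classes are the nonempty fibres
-- (empty fibres have sum 0 and are harmless).

module SRR {c ℓ ℓ₂ : Level} (F : OrderedFloorRing c ℓ ℓ₂) where
  open OrderedFloorRing F

  Vector : ℕ → Set c
  Vector n = Fin n → Carrier

  sumD : ∀ {n} → Vector n → Carrier
  sumD {zero}   x = 0#
  sumD {sucℕ n} x = x fzero + sumD (λ i → x (fsuc i))

  _·_ : ∀ {n} → Vector n → Vector n → Carrier
  c · x = sumD (λ i → c i * x i)

  classSum : ∀ {n m} → (Fin n → Fin m) → Vector n → Fin m → Carrier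
  classSum p x s = sumD (λ i → ind (p i ≟ s) (x i))
    where
      ind : ∀ {A : Set} → Dec A → Carrier → Carrier
      ind (yes _) v = v
      ind (no _)  v = 0#

  invPow2 : ℕ → Carrier
  invPow2 k = pow half k

  ⌈_⌉ : Carrier → ℤ
  ⌈ x ⌉ = ℤ.- ⌊ - x ⌋

  Feasible : ∀ {n m} (p : Fin n → Fin m) (lam : Vector n) (K : ℕ) → Vector n → Set ℓ
  Feasible p lam K μ =
      (∀ i → (μ i ≈ (fromℤ ⌊ pow two K * lam i ⌋ * invPow2 K))
           ⊎ (μ i ≈ (fromℤ ⌈ pow two K * lam i ⌉ * invPow2 K)))
    × (∀ s → classSum p μ s ≈ classSum p lam s)

  IsInitial : ∀ {n m} (p : Fin n → Fin m) (lam : Vector n) (K : ℕ) (cv : Vector n)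
              → Vector n → Set (c ⊔ ℓ ⊔ ℓ₂)
  IsInitial p lam K cv μ =
    Feasible p lam K μ × (∀ μ' → Feasible p lam K μ' → (cv · μ) ≤ (cv · μ'))

  -- i ∈ S_k  ⟺  2^k x_i ∉ ℤ   (x = λ⁽ᵏ⁺¹⁾)
  InS : ∀ {n} → ℕ → Vector n → Fin n → Set ℓ
  InS k x i = ¬ IsInteger (pow two k * x i)

  -- A perfect matching M on S_k whose pairs lie in a common class,
  -- given as a partner map restricted to S_k.
  IsMatching : ∀ {n m} (p : Fin n → Fin m) (k : ℕ) (x : Vector n)
               → (Fin n → Fin n) → Set ℓ
  IsMatching p k x partner =
    ∀ i → InS k x i →
        InS k x (partner i) × ¬ (partner i ≡ i)
      × partner (partner i) ≡ i × p (partner i) ≡ p i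

  -- the outcome of the coin flips: for each pair exactly one endpoint
  -- gets +1/2 (flag true) and the other -1/2 (flag false)
  IsOrientation : ∀ {n} (k : ℕ) (x : Vector n)
                  → (Fin n → Fin n) → (Fin n → Bool) → Set ℓ
  IsOrientation k x partner σ = ∀ i → InS k x i → σ (partner i) ≡ not (σ i)

  IsNu : ∀ {n} (k : ℕ) (x : Vector n) (σ : Fin n → Bool) → Vector n → Set ℓ
  IsNu k x σ ν = ∀ i →
      (InS k x i → σ i ≡ true → ν i ≈ half)
    × (InS k x i → σ i ≡ false → ν i ≈ - half)
    × (¬ InS k x i → ν i ≈ 0#)

  -- one iteration k: from x = λ⁽ᵏ⁺¹⁾ to y = λ⁽ᵏ⁾
  Step : ∀ {n m} (p : Fin n → Fin m) (cv : Vector n) (k : ℕ)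
         → Vector n → Vector n → Set (c ⊔ ℓ ⊔ ℓ₂)
  Step {n} p cv k x y =
    Σ[ partner ∈ (Fin n → Fin n) ] Σ[ σ ∈ (Fin n → Bool) ]
    Σ[ ν ∈ Vector n ] Σ[ ν' ∈ Vector n ]
      IsMatching p k x partner × IsOrientation k x partner σ × IsNu k x σ ν
    × ((∀ i → ν' i ≈ ν i) ⊎ (∀ i → ν' i ≈ - ν i))
    × ((cv · ν') ≤ 0#)
    × (∀ i → y i ≈ (x i + ν' i * invPow2 k))

  -- an execution: the sequence λ⁽ᴷ⁾, λ⁽ᴷ⁻¹⁾, …, λ⁽⁰⁾ (indexed by k)
  record Execution {n m} (p : Fin n → Fin m) (lam : Vector n) (K : ℕ)
                   (cv : Vector n) : Set (c ⊔ ℓ ⊔ ℓ₂) where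
    field
      iterate : ℕ → Vector n
      initial : IsInitial p lam K cv (iterate K)
      step    : ∀ k → k < K → Step p cv k (iterate (sucℕ k)) (iterate k)
    output : Vector n
    output = iterate 0

-- Each rounding step adds ν′/2^k, where ν puts opposite signs ±1/2 on the two ends of
-- every matched pair; the pairs lie inside classes, so ν′ has zero class sums, and the
-- choice of sign gives cᵀν′ ≤ 0.  Hence it suffices that cᵀλ⁽ᴷ⁾ ≤ cᵀλ, and since λ⁽ᴷ⁾ is
-- a minimiser it suffices to exhibit one feasible μ with cᵀμ ≤ cᵀλ.
-- Write 2ᴷλ = ⌊2ᴷλ⌋ + t, so 0 ≤ tᵢ ≤ gᵢ := ⌈2ᴷλᵢ⌉ − ⌊2ᴷλᵢ⌋ ∈ {0,1} and t has integral
-- class sums.  While some tᵢ is fractional, its class (having an integral sum) contains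
-- a second fractional tⱼ; moving mass between them towards the cheaper coordinate until
-- one becomes integral keeps t in the box, keeps the class sums and does not increase
-- the cost.  The resulting t′ ∈ ∏ᵢ {0, gᵢ} gives μ = 2⁻ᴷ(⌊2ᴷλ⌋ + t′).

module Submission where

open import Defs
open import Level using (Level; _⊔_)
open import Function using (_∘_; id)
open import Data.Nat as ℕ using (ℕ; zero; suc)
import Data.Nat.Properties as ℕP
open import Data.Integer as ℤ using (ℤ; +_; -[1+_])
import Data.Integer.Properties as ℤP
import Data.Sign as Sign
open import Data.Fin using (Fin; _≟_) renaming (zero to fzero; suc to fsuc)
open import Data.Fin.Properties using (any?; suc-injective)
import Data.Fin.Permutation as Perm
open import Data.Fin.Subset using (Subset; _∈_; _⊆_; _⊂_)
open import Data.Fin.Subset.Induction using (⊂-wellFounded)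
open import Data.Vec using (tabulate)
open import Data.Vec.Properties using (lookup∘tabulate; []=⇒lookup; lookup⇒[]=)
open import Data.Bool using (true; false; not)
open import Data.Maybe using (Maybe; just; nothing)
open import Data.Product using (_×_; _,_; proj₁; proj₂; Σ-syntax; ∃-syntax)
open import Data.Sum using (_⊎_; inj₁; inj₂)
open import Data.Empty using (⊥-elim)
open import Relation.Nullary using (¬_; Dec; yes; no; does; ¬?)
open import Relation.Nullary.Decidable using (_×-dec_; dec-true; dec-false; decidable-stable)
open import Relation.Binary.PropositionalEquality as P using (_≡_; _≢_)
open import Relation.Binary.Structures using (IsTotalOrder)
open import Induction.WellFounded using (Acc; acc)
open import Algebra.Bundles using (CommutativeRing)
open import Algebra.Solver.Ring.AlmostCommutativeRing
  using (fromCommutativeRing; _-Raw-AlmostCommutative⟶_)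

module OrderedFloorRingProperties {a ℓ ℓ₂ : Level} (F : OrderedFloorRing a ℓ ℓ₂) where
  open OrderedFloorRing F
  open SRR F using (⌈_⌉; invPow2)
  open import Algebra.Properties.Ring ring
    using (-0#≈0#; -‿involutive; -‿+-comm; -‿distribˡ-*; -‿distribʳ-*)
  open import Algebra.Properties.Semiring.Mult semiring as Mult using (×-homo-+; ×1-homo-*)
  import Algebra.Solver.CommutativeMonoid +-commutativeMonoid as CM
  open import Relation.Binary.Reasoning.Setoid setoid
  module ≤ = IsTotalOrder isTotalOrder

  fromℕ≡×1 : ∀ n → fromℕ n ≡ n Mult.× 1#
  fromℕ≡×1 zero    = P.refl
  fromℕ≡×1 (suc n) = P.cong (_+_ 1#) (fromℕ≡×1 n)

  fromℕ-+ : ∀ m n → fromℕ (m ℕ.+ n) ≈ fromℕ m + fromℕ n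
  fromℕ-+ m n rewrite fromℕ≡×1 (m ℕ.+ n) | fromℕ≡×1 m | fromℕ≡×1 n = ×-homo-+ 1# m n

  fromℕ-* : ∀ m n → fromℕ (m ℕ.* n) ≈ fromℕ m * fromℕ n
  fromℕ-* m n rewrite fromℕ≡×1 (m ℕ.* n) | fromℕ≡×1 m | fromℕ≡×1 n = ×1-homo-* m n

  fromℤ-⊖ : ∀ m n → fromℤ (m ℤ.⊖ n) ≈ fromℕ m - fromℕ n
  fromℤ-⊖ zero    zero    = sym (-‿inverseʳ 0#)
  fromℤ-⊖ (suc m) zero    = sym (trans (+-congˡ -0#≈0#) (+-identityʳ _))
  fromℤ-⊖ zero    (suc n) = sym (+-identityˡ _)
  fromℤ-⊖ (suc m) (suc n) rewrite ℤP.[1+m]⊖[1+n]≡m⊖n m n = begin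
    fromℤ (m ℤ.⊖ n)                 ≈⟨ fromℤ-⊖ m n ⟩
    fromℕ m + - fromℕ n             ≈⟨ sym (+-identityˡ _) ⟩
    0# + (fromℕ m + - fromℕ n)      ≈⟨ +-congʳ (sym (-‿inverseʳ 1#)) ⟩
    (1# + - 1#) + (fromℕ m + - fromℕ n)
      ≈⟨ CM.solve 4 (λ a b c d → (a CM.⊕ c) CM.⊕ (b CM.⊕ d) CM.⊜ (a CM.⊕ b) CM.⊕ (c CM.⊕ d))
                    refl 1# (fromℕ m) (- 1#) (- fromℕ n) ⟩
    (1# + fromℕ m) + (- 1# + - fromℕ n) ≈⟨ +-congˡ (-‿+-comm 1# (fromℕ n)) ⟩
    (1# + fromℕ m) - (1# + fromℕ n) ∎

  fromℤ-+ : ∀ x y → fromℤ (x ℤ.+ y) ≈ fromℤ x + fromℤ y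
  fromℤ-+ (+ m)    (+ n)    = fromℕ-+ m n
  fromℤ-+ (+ m)    -[1+ n ] = fromℤ-⊖ m (suc n)
  fromℤ-+ -[1+ m ] (+ n)    = trans (fromℤ-⊖ n (suc m)) (+-comm _ _)
  fromℤ-+ -[1+ m ] -[1+ n ] = begin
    - (1# + (1# + fromℕ (m ℕ.+ n)))       ≈⟨ -‿cong (+-congˡ (+-congˡ (fromℕ-+ m n))) ⟩
    - (1# + (1# + (fromℕ m + fromℕ n)))
      ≈⟨ -‿cong (CM.solve 3 (λ a b c → a CM.⊕ (a CM.⊕ (b CM.⊕ c)) CM.⊜ (a CM.⊕ b) CM.⊕ (a CM.⊕ c))
                           refl 1# (fromℕ m) (fromℕ n)) ⟩
    - ((1# + fromℕ m) + (1# + fromℕ n))   ≈⟨ sym (-‿+-comm _ _) ⟩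
    - (1# + fromℕ m) + - (1# + fromℕ n)   ∎

  fromℤ-neg : ∀ x → fromℤ (ℤ.- x) ≈ - fromℤ x
  fromℤ-neg (+ zero)  = sym -0#≈0#
  fromℤ-neg (+ suc n) = refl
  fromℤ-neg -[1+ n ]  = sym (-‿involutive _)

  fromℤ-◃⁺ : ∀ n → fromℤ (Sign.+ ℤ.◃ n) ≈ fromℕ n
  fromℤ-◃⁺ zero    = refl
  fromℤ-◃⁺ (suc n) = refl

  fromℤ-◃⁻ : ∀ n → fromℤ (Sign.- ℤ.◃ n) ≈ - fromℕ n
  fromℤ-◃⁻ zero    = sym -0#≈0#
  fromℤ-◃⁻ (suc n) = refl

  fromℤ-* : ∀ x y → fromℤ (x ℤ.* y) ≈ fromℤ x * fromℤ y
  fromℤ-* (+ m)    (+ n)    = trans (fromℤ-◃⁺ (m ℕ.* n)) (fromℕ-* m n)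
  fromℤ-* (+ m)    -[1+ n ] =
    trans (fromℤ-◃⁻ (m ℕ.* suc n)) (trans (-‿cong (fromℕ-* m (suc n))) (-‿distribʳ-* _ _))
  fromℤ-* -[1+ m ] (+ n)    =
    trans (fromℤ-◃⁻ (suc m ℕ.* n)) (trans (-‿cong (fromℕ-* (suc m) n)) (-‿distribˡ-* _ _))
  fromℤ-* -[1+ m ] -[1+ n ] = begin
    fromℤ (Sign.+ ℤ.◃ (suc m ℕ.* suc n))  ≈⟨ fromℤ-◃⁺ (suc m ℕ.* suc n) ⟩
    fromℕ (suc m ℕ.* suc n)               ≈⟨ fromℕ-* (suc m) (suc n) ⟩
    fromℕ (suc m) * fromℕ (suc n)         ≈⟨ sym (-‿involutive _) ⟩
    - - (fromℕ (suc m) * fromℕ (suc n))   ≈⟨ -‿cong (-‿distribˡ-* _ _) ⟩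
    - (- fromℕ (suc m) * fromℕ (suc n))   ≈⟨ -‿distribʳ-* _ _ ⟩
    - fromℕ (suc m) * - fromℕ (suc n)     ∎

  private
    ℤ⟶R : CommutativeRing.rawRing ℤP.+-*-commutativeRing -Raw-AlmostCommutative⟶ fromCommutativeRing cring
    ℤ⟶R = record
      { ⟦_⟧ = fromℤ ; +-homo = fromℤ-+ ; *-homo = fromℤ-* ; -‿homo = fromℤ-neg
      ; 0-homo = refl ; 1-homo = +-identityʳ 1# }

    fromℤ-≟ : (x y : ℤ) → Maybe (fromℤ x ≈ fromℤ y)
    fromℤ-≟ x y with x ℤ.≟ y
    ... | yes x≡y = just (reflexive (P.cong fromℤ x≡y))
    ... | no _    = nothing

  open import Algebra.Solver.Ring (CommutativeRing.rawRing ℤP.+-*-commutativeRing)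
    (fromCommutativeRing cring) ℤ⟶R fromℤ-≟ public
    using (solve; _:=_; _:+_; _:*_; _:-_; :-_; con)

  ≤-respˡʳ-≈ : ∀ {x x′ y y′} → x ≈ x′ → y ≈ y′ → x ≤ y → x′ ≤ y′
  ≤-respˡʳ-≈ x≈x′ y≈y′ = ≤.≤-respʳ-≈ y≈y′ ∘ ≤.≤-respˡ-≈ x≈x′

  +-monoʳ-≤ : ∀ {x y} z → x ≤ y → (z + x) ≤ (z + y)
  +-monoʳ-≤ {x} {y} z = ≤-respˡʳ-≈ (+-comm x z) (+-comm y z) ∘ +-monoˡ-≤ z

  +-mono-≤ : ∀ {x y u v} → x ≤ y → u ≤ v → (x + u) ≤ (y + v)
  +-mono-≤ {y = y} {u} x≤y u≤v = ≤.trans (+-monoˡ-≤ u x≤y) (+-monoʳ-≤ y u≤v)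

  x≤y⇒0≤y-x : ∀ {x y} → x ≤ y → 0# ≤ (y - x)
  x≤y⇒0≤y-x {x} = ≤-respˡʳ-≈ (-‿inverseʳ x) refl ∘ +-monoˡ-≤ (- x)

  0≤y-x⇒x≤y : ∀ {x y} → 0# ≤ (y - x) → x ≤ y
  0≤y-x⇒x≤y {x} {y} =
    ≤-respˡʳ-≈ (+-identityˡ x) (solve 2 (λ x y → (y :- x) :+ x := y) refl x y) ∘ +-monoˡ-≤ x

  neg-antimono-≤ : ∀ {x y} → x ≤ y → (- y) ≤ (- x)
  neg-antimono-≤ {x} {y} =
    ≤-respˡʳ-≈ (solve 2 (λ x y → x :+ (:- x :+ :- y) := :- y) refl x y)
               (solve 2 (λ x y → y :+ (:- x :+ :- y) := :- x) refl x y)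
    ∘ +-monoˡ-≤ (- x + - y)

  *-monoʳ-≤ : ∀ {x y} h → 0# ≤ h → x ≤ y → (x * h) ≤ (y * h)
  *-monoʳ-≤ {x} {y} h 0≤h x≤y = 0≤y-x⇒x≤y
    (≤-respˡʳ-≈ refl (solve 3 (λ x y h → (y :- x) :* h := y :* h :- x :* h) refl x y h)
                (*-nonneg (x≤y⇒0≤y-x x≤y) 0≤h))

  -- 1 ≤ 0 would make -1 nonnegative, hence also 1 = (-1)(-1).
  0≤1 : 0# ≤ 1#
  0≤1 with ≤.total 0# 1#
  ... | inj₁ 0≤1 = 0≤1
  ... | inj₂ 1≤0 = ≤-respˡʳ-≈ refl (trans (solve 1 (λ o → :- o :* :- o := o :* o) refl 1#) (*-identityʳ 1#))
                              (*-nonneg 0≤-1 0≤-1)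
    where
    0≤-1 : 0# ≤ (- 1#)
    0≤-1 = ≤-respˡʳ-≈ (-‿inverseʳ 1#) (+-identityˡ (- 1#)) (+-monoˡ-≤ (- 1#) 1≤0)

  0≉1 : ¬ (0# ≈ 1#)
  0≉1 0≈1 = proj₂ (floor-< 0#) (begin
    0#                      ≈⟨ sym (zeroʳ _) ⟩
    (fromℤ ⌊ 0# ⌋ + 1#) * 0# ≈⟨ *-congˡ 0≈1 ⟩
    (fromℤ ⌊ 0# ⌋ + 1#) * 1# ≈⟨ *-identityʳ _ ⟩
    fromℤ ⌊ 0# ⌋ + 1#        ∎)

  x≉x+1 : ∀ x → ¬ (x ≈ x + 1#)
  x≉x+1 x x≈x+1 = 0≉1 (begin
    0#            ≈⟨ sym (-‿inverseʳ x) ⟩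
    x - x         ≈⟨ +-congʳ x≈x+1 ⟩
    (x + 1#) - x  ≈⟨ solve 2 (λ x o → (x :+ o) :- x := o) refl x 1# ⟩
    1#            ∎)

  0≤half : 0# ≤ half
  0≤half with ≤.total 0# half
  ... | inj₁ 0≤half = 0≤half
  ... | inj₂ half≤0 = ⊥-elim (0≉1 (≤.antisym 0≤1
          (≤-respˡʳ-≈ half+half (+-identityʳ 0#) (+-mono-≤ half≤0 half≤0))))

  0≤invPow2 : ∀ k → 0# ≤ invPow2 k
  0≤invPow2 zero    = 0≤1
  0≤invPow2 (suc k) = *-nonneg 0≤half (0≤invPow2 k)

  pow2*invPow2 : ∀ k → pow two k * invPow2 k ≈ 1#
  pow2*invPow2 zero    = *-identityʳ 1#
  pow2*invPow2 (suc k) = begin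
    (two * pow two k) * (half * invPow2 k)  ≈⟨ solve 4 (λ t h x y → (t :* x) :* (h :* y) := (t :* h) :* (x :* y))
                                                        refl two half (pow two k) (invPow2 k) ⟩
    (two * half) * (pow two k * invPow2 k)  ≈⟨ *-cong two*half≈1 (pow2*invPow2 k) ⟩
    1# * 1#                                 ≈⟨ *-identityʳ 1# ⟩
    1#                                      ∎
    where
    two*half≈1 : two * half ≈ 1#
    two*half≈1 = trans (distribʳ half 1# 1#) (trans (+-cong (*-identityˡ half) (*-identityˡ half)) half+half)

  x≈-x⇒x≈0 : ∀ {x} → x ≈ - x → x ≈ 0#
  x≈-x⇒x≈0 {x} x≈-x = begin
    x                        ≈⟨ sym (*-identityʳ x) ⟩
    x * 1#                   ≈⟨ *-congˡ (sym half+half) ⟩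
    x * (half + half)        ≈⟨ distribˡ x half half ⟩
    x * half + x * half      ≈⟨ +-congˡ (*-congʳ x≈-x) ⟩
    x * half + - x * half    ≈⟨ solve 2 (λ x h → x :* h :+ (:- x) :* h := con (+ 0)) refl x half ⟩
    0#                       ∎

  0≤fromℕ : ∀ n → 0# ≤ fromℕ n
  0≤fromℕ zero    = ≤.reflexive refl
  0≤fromℕ (suc n) = ≤-respˡʳ-≈ (+-identityʳ 0#) refl (+-mono-≤ 0≤1 (0≤fromℕ n))

  1≤fromℕ-suc : ∀ n → 1# ≤ fromℕ (suc n)
  1≤fromℕ-suc n = ≤-respˡʳ-≈ (+-identityʳ 1#) refl (+-monoʳ-≤ 1# (0≤fromℕ n))

  fromℤ-suc : ∀ z → fromℤ (z ℤ.+ + 1) ≈ fromℤ z + 1#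
  fromℤ-suc z = trans (fromℤ-+ z (+ 1)) (+-congˡ (+-identityʳ 1#))

  fromℤ-between-±1 : ∀ z → ¬ (1# ≤ fromℤ z) → ¬ (fromℤ z ≤ (- 1#)) → z ≡ + 0
  fromℤ-between-±1 (+ zero)  _   _    = P.refl
  fromℤ-between-±1 (+ suc n) 1≰z _    = ⊥-elim (1≰z (1≤fromℕ-suc n))
  fromℤ-between-±1 -[1+ n ]  _   z≰-1 = ⊥-elim (z≰-1 (neg-antimono-≤ (1≤fromℕ-suc n)))

  ⌊⌋-unique : ∀ z {y} → fromℤ z ≤ y → y ≤ (fromℤ z + 1#) → ¬ (y ≈ (fromℤ z + 1#)) → ⌊ y ⌋ ≡ z
  ⌊⌋-unique z {y} z≤y y≤z+1 y≉z+1 =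
    P.sym (ℤP.i-j≡0⇒i≡j z b (fromℤ-between-±1 (z ℤ.- b) 1≰z-b z-b≰-1))
    where
    b = ⌊ y ⌋
    fromℤ-z-b : fromℤ (z ℤ.- b) ≈ fromℤ z - fromℤ b
    fromℤ-z-b = trans (fromℤ-+ z (ℤ.- b)) (+-congˡ (fromℤ-neg b))
    1≰z-b : ¬ (1# ≤ fromℤ (z ℤ.- b))
    1≰z-b 1≤z-b = proj₂ (floor-< y) (≤.antisym (proj₁ (floor-< y)) (≤.trans b+1≤z z≤y))
      where
      b+1≤z : (fromℤ b + 1#) ≤ fromℤ z
      b+1≤z = ≤-respˡʳ-≈ (+-comm 1# (fromℤ b)) (solve 2 (λ z b → (z :- b) :+ b := z) refl (fromℤ z) (fromℤ b))
                         (+-monoˡ-≤ (fromℤ b) (≤-respˡʳ-≈ refl fromℤ-z-b 1≤z-b))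
    z-b≰-1 : ¬ (fromℤ (z ℤ.- b) ≤ (- 1#))
    z-b≰-1 z-b≤-1 = y≉z+1 (≤.antisym y≤z+1 (≤.trans z+1≤b (floor-≤ y)))
      where
      z+1≤b : (fromℤ z + 1#) ≤ fromℤ b
      z+1≤b = ≤-respˡʳ-≈ (solve 3 (λ z b o → (z :- b) :+ (b :+ o) := z :+ o) refl (fromℤ z) (fromℤ b) 1#)
                         (solve 2 (λ b o → :- o :+ (b :+ o) := b) refl (fromℤ b) 1#)
                         (+-monoˡ-≤ (fromℤ b + 1#) (≤-respˡʳ-≈ fromℤ-z-b refl z-b≤-1))

  ⌊⌋-fromℤ : ∀ z {y} → y ≈ fromℤ z → ⌊ y ⌋ ≡ z
  ⌊⌋-fromℤ z {y} y≈z = ⌊⌋-unique z (≤.reflexive (sym y≈z))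
    (≤.trans (≤.reflexive y≈z) (≤-respˡʳ-≈ (+-identityʳ _) refl (+-monoʳ-≤ (fromℤ z) 0≤1)))
    (λ y≈z+1 → x≉x+1 (fromℤ z) (trans (sym y≈z) y≈z+1))

  ⌈⌉-fromℤ : ∀ z {y} → y ≈ fromℤ z → ⌈ y ⌉ ≡ z
  ⌈⌉-fromℤ z {y} y≈z = P.trans (P.cong ℤ.-_ (⌊⌋-fromℤ (ℤ.- z) -y≈-z)) (ℤP.neg-involutive z)
    where
    -y≈-z : - y ≈ fromℤ (ℤ.- z)
    -y≈-z = trans (-‿cong y≈z) (sym (fromℤ-neg z))

  y≤⌈y⌉ : ∀ y → y ≤ fromℤ ⌈ y ⌉
  y≤⌈y⌉ y = ≤-respˡʳ-≈ (-‿involutive y) (sym (fromℤ-neg ⌊ - y ⌋)) (neg-antimono-≤ (floor-≤ (- y)))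

  IsInteger? : ∀ y → Dec (IsInteger y)
  IsInteger? y with ⌈ y ⌉ ℤ.≟ ⌊ y ⌋
  ... | yes ⌈y⌉≡⌊y⌋ = yes (⌊ y ⌋ , ≤.antisym (≤.trans (y≤⌈y⌉ y) (≤.reflexive (reflexive (P.cong fromℤ ⌈y⌉≡⌊y⌋))))
                                             (floor-≤ y))
  ... | no  ⌈y⌉≢⌊y⌋ = no λ (z , y≈z) → ⌈y⌉≢⌊y⌋ (P.trans (⌈⌉-fromℤ z y≈z) (P.sym (⌊⌋-fromℤ z y≈z)))

  ⌈⌉-nonInteger : ∀ {y} → ¬ IsInteger y → ⌈ y ⌉ ≡ ⌊ y ⌋ ℤ.+ + 1
  ⌈⌉-nonInteger {y} y∉ℤ = P.trans (P.cong ℤ.-_ ⌊-y⌋≡-[b+1]) (ℤP.neg-involutive _)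
    where
    b = ⌊ y ⌋
    fromℤ-[b+1] : fromℤ (ℤ.- (b ℤ.+ + 1)) ≈ - (fromℤ b + 1#)
    fromℤ-[b+1] = trans (fromℤ-neg (b ℤ.+ + 1)) (-‿cong (fromℤ-suc b))
    -[b+1]+1≈-b : (fromℤ (ℤ.- (b ℤ.+ + 1)) + 1#) ≈ - fromℤ b
    -[b+1]+1≈-b = trans (+-congʳ fromℤ-[b+1]) (solve 2 (λ b o → :- (b :+ o) :+ o := :- b) refl (fromℤ b) 1#)
    ⌊-y⌋≡-[b+1] : ⌊ - y ⌋ ≡ ℤ.- (b ℤ.+ + 1)
    ⌊-y⌋≡-[b+1] = ⌊⌋-unique _
      (≤-respˡʳ-≈ (sym fromℤ-[b+1]) refl (neg-antimono-≤ (proj₁ (floor-< y))))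
      (≤-respˡʳ-≈ refl (sym -[b+1]+1≈-b) (neg-antimono-≤ (floor-≤ y)))
      (λ -y≈ → y∉ℤ (b , trans (sym (-‿involutive y)) (trans (-‿cong (trans -y≈ -[b+1]+1≈-b)) (-‿involutive _))))

  IsInteger-resp : ∀ {x y} → x ≈ y → IsInteger x → IsInteger y
  IsInteger-resp x≈y (z , x≈z) = z , trans (sym x≈y) x≈z

  IsInteger-0 : IsInteger 0#
  IsInteger-0 = + 0 , refl

  IsInteger-1 : IsInteger 1#
  IsInteger-1 = + 1 , sym (+-identityʳ 1#)

  IsInteger-+ : ∀ {x y} → IsInteger x → IsInteger y → IsInteger (x + y)
  IsInteger-+ (z , x≈z) (w , y≈w) = z ℤ.+ w , trans (+-cong x≈z y≈w) (sym (fromℤ-+ z w))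

  IsInteger-neg : ∀ {x} → IsInteger x → IsInteger (- x)
  IsInteger-neg (z , x≈z) = ℤ.- z , trans (-‿cong x≈z) (sym (fromℤ-neg z))

  IsInteger-* : ∀ {x y} → IsInteger x → IsInteger y → IsInteger (x * y)
  IsInteger-* (z , x≈z) (w , y≈w) = z ℤ.* w , trans (*-cong x≈z y≈w) (sym (fromℤ-* z w))

  IsInteger-pow2 : ∀ k → IsInteger (pow two k)
  IsInteger-pow2 zero    = IsInteger-1
  IsInteger-pow2 (suc k) = IsInteger-* (IsInteger-+ IsInteger-1 IsInteger-1) (IsInteger-pow2 k)

  IsInteger-0≤x≤1 : ∀ {x} → IsInteger x → 0# ≤ x → x ≤ 1# → (x ≈ 0#) ⊎ (x ≈ 1#)
  IsInteger-0≤x≤1 (+ zero , x≈0) _ _ = inj₁ x≈0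
  IsInteger-0≤x≤1 (+ suc zero , x≈1) _ _ = inj₂ (trans x≈1 (+-identityʳ 1#))
  IsInteger-0≤x≤1 (+ suc (suc n) , x≈2+n) _ x≤1 = ⊥-elim (0≉1 (≤.antisym 0≤1 1≤0))
    where
    1+1≤1 : (1# + 1#) ≤ 1#
    1+1≤1 = ≤.trans (≤-respˡʳ-≈ refl (sym x≈2+n) (+-monoʳ-≤ 1# (1≤fromℕ-suc n))) x≤1
    1≤0 : 1# ≤ 0#
    1≤0 = ≤-respˡʳ-≈ (solve 1 (λ o → (o :+ o) :- o := o) refl 1#) (-‿inverseʳ 1#) (+-monoˡ-≤ (- 1#) 1+1≤1)
  IsInteger-0≤x≤1 (-[1+ n ] , x≈-n-1) 0≤x _ = ⊥-elim (0≉1 (≤.antisym 0≤1 1≤0))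
    where
    1≤0 : 1# ≤ 0#
    1≤0 = ≤-respˡʳ-≈ (-‿involutive 1#) -0#≈0#
            (neg-antimono-≤ (≤.trans 0≤x (≤-respˡʳ-≈ (sym x≈-n-1) refl (neg-antimono-≤ (1≤fromℕ-suc n)))))

  frac : Carrier → Carrier
  frac y = y - fromℤ ⌊ y ⌋

  ceilGap : Carrier → Carrier
  ceilGap y = fromℤ ⌈ y ⌉ - fromℤ ⌊ y ⌋

  ceilGap-0or1 : ∀ y → (ceilGap y ≈ 0#) ⊎ (ceilGap y ≈ 1#)
  ceilGap-0or1 y with IsInteger? y
  ... | yes (z , y≈z) rewrite ⌈⌉-fromℤ z y≈z | ⌊⌋-fromℤ z y≈z = inj₁ (-‿inverseʳ (fromℤ z))
  ... | no  y∉ℤ       rewrite ⌈⌉-nonInteger y∉ℤ =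
    inj₂ (trans (+-congʳ (fromℤ-suc ⌊ y ⌋)) (solve 2 (λ b o → (b :+ o) :- b := o) refl (fromℤ ⌊ y ⌋) 1#))

  0≤frac : ∀ y → 0# ≤ frac y
  0≤frac y = x≤y⇒0≤y-x (floor-≤ y)

  frac≤ceilGap : ∀ y → frac y ≤ ceilGap y
  frac≤ceilGap y = +-monoˡ-≤ (- fromℤ ⌊ y ⌋) (y≤⌈y⌉ y)

module SemiRandomRoundingProperties {a ℓ ℓ₂ : Level} (F : OrderedFloorRing a ℓ ℓ₂) where
  open OrderedFloorRing F
  open SRR F
  open OrderedFloorRingProperties F
  open import Algebra.Properties.Ring ring
    using (-0#≈0#; -‿involutive; -‿+-comm; -‿distribˡ-*; -‿distribʳ-*)
  open import Algebra.Properties.Semiring.Sum semiring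
    using (sum; sum-cong-≋; ∑-distrib-+; *-distribʳ-sum; sum-permute)
  open import Relation.Binary.Reasoning.Setoid setoid

  sumD≡sum : ∀ {n} (x : Vector n) → sumD x ≡ sum x
  sumD≡sum {zero}  x = P.refl
  sumD≡sum {suc n} x = P.cong (_+_ (x fzero)) (sumD≡sum (x ∘ fsuc))

  sumD-cong : ∀ {n} {x y : Vector n} → (∀ i → x i ≈ y i) → sumD x ≈ sumD y
  sumD-cong {x = x} {y} x≈y rewrite sumD≡sum x | sumD≡sum y = sum-cong-≋ x≈y

  sumD-+ : ∀ {n} (x y : Vector n) → sumD (λ i → x i + y i) ≈ sumD x + sumD y
  sumD-+ x y rewrite sumD≡sum (λ i → x i + y i) | sumD≡sum x | sumD≡sum y = ∑-distrib-+ x y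

  sumD-*ʳ : ∀ {n} (x : Vector n) h → sumD (λ i → x i * h) ≈ sumD x * h
  sumD-*ʳ x h rewrite sumD≡sum (λ i → x i * h) | sumD≡sum x = sym (*-distribʳ-sum h x)

  sumD-∘-involution : ∀ {n} (x : Vector n) (π : Fin n → Fin n) → (∀ i → π (π i) ≡ i) →
                      sumD x ≈ sumD (x ∘ π)
  sumD-∘-involution x π π∘π≡id rewrite sumD≡sum x | sumD≡sum (x ∘ π) =
    sum-permute x (Perm.permutation π π π∘π≡id π∘π≡id)

  sumD-neg : ∀ {n} (x : Vector n) → sumD (λ i → - x i) ≈ - sumD x
  sumD-neg {zero}  x = sym -0#≈0#
  sumD-neg {suc n} x = trans (+-congˡ (sumD-neg (x ∘ fsuc))) (-‿+-comm _ _)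

  sumD-zero : ∀ {n} (x : Vector n) → (∀ i → x i ≈ 0#) → sumD x ≈ 0#
  sumD-zero {zero}  x _   = refl
  sumD-zero {suc n} x x≈0 = trans (+-cong (x≈0 fzero) (sumD-zero (x ∘ fsuc) (x≈0 ∘ fsuc))) (+-identityʳ 0#)

  sumD-single : ∀ {n} (x : Vector n) j → (∀ i → i ≢ j → x i ≈ 0#) → sumD x ≈ x j
  sumD-single x fzero    x≈0 =
    trans (+-congˡ (sumD-zero (x ∘ fsuc) (λ i → x≈0 (fsuc i) λ ()))) (+-identityʳ _)
  sumD-single x (fsuc j) x≈0 =
    trans (+-cong (x≈0 fzero λ ()) (sumD-single (x ∘ fsuc) j (λ i i≢j → x≈0 (fsuc i) (i≢j ∘ suc-injective))))
          (+-identityˡ _)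

  sumD-antisymmetric : ∀ {n} (x : Vector n) (π : Fin n → Fin n) → (∀ i → π (π i) ≡ i) →
                       (∀ i → x (π i) ≈ - x i) → sumD x ≈ 0#
  sumD-antisymmetric x π π∘π≡id x∘π≈-x = x≈-x⇒x≈0 (begin
    sumD x                ≈⟨ sumD-∘-involution x π π∘π≡id ⟩
    sumD (x ∘ π)          ≈⟨ sumD-cong x∘π≈-x ⟩
    sumD (λ i → - x i)    ≈⟨ sumD-neg x ⟩
    - sumD x              ∎)

  IsInteger-sumD : ∀ {n} (x : Vector n) → (∀ i → IsInteger (x i)) → IsInteger (sumD x)
  IsInteger-sumD {zero}  x _    = IsInteger-0
  IsInteger-sumD {suc n} x x∈ℤ = IsInteger-+ (x∈ℤ fzero) (IsInteger-sumD (x ∘ fsuc) (x∈ℤ ∘ fsuc))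

  IsInteger-sumD⁻ : ∀ {n} (x : Vector n) j → (∀ i → i ≢ j → IsInteger (x i)) →
                    IsInteger (sumD x) → IsInteger (x j)
  IsInteger-sumD⁻ x fzero    x∈ℤ Σ∈ℤ =
    IsInteger-resp (solve 2 (λ x₀ r → (x₀ :+ r) :- r := x₀) refl (x fzero) _)
      (IsInteger-+ Σ∈ℤ (IsInteger-neg (IsInteger-sumD (x ∘ fsuc) (λ i → x∈ℤ (fsuc i) λ ()))))
  IsInteger-sumD⁻ x (fsuc j) x∈ℤ Σ∈ℤ = IsInteger-sumD⁻ (x ∘ fsuc) j (λ i i≢j → x∈ℤ (fsuc i) (i≢j ∘ suc-injective))
    (IsInteger-resp (solve 2 (λ x₀ r → :- x₀ :+ (x₀ :+ r) := r) refl (x fzero) _)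
      (IsInteger-+ (IsInteger-neg (x∈ℤ fzero λ ())) Σ∈ℤ))

  ·-cong : ∀ {n} (w : Vector n) {x y : Vector n} → (∀ i → x i ≈ y i) → (w · x) ≈ (w · y)
  ·-cong w x≈y = sumD-cong (λ i → *-congˡ (x≈y i))

  ·-+ : ∀ {n} (w x y : Vector n) → (w · (λ i → x i + y i)) ≈ ((w · x) + (w · y))
  ·-+ w x y = trans (sumD-cong (λ i → distribˡ (w i) (x i) (y i))) (sumD-+ (λ i → w i * x i) (λ i → w i * y i))

  ·-neg : ∀ {n} (w x : Vector n) → (w · (λ i → - x i)) ≈ (- (w · x))
  ·-neg w x = trans (sumD-cong (λ i → sym (-‿distribʳ-* (w i) (x i)))) (sumD-neg (λ i → w i * x i))

  ·-*ʳ : ∀ {n} (w x : Vector n) h → (w · (λ i → x i * h)) ≈ ((w · x) * h)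
  ·-*ʳ w x h = trans (sumD-cong (λ i → sym (*-assoc (w i) (x i) h))) (sumD-*ʳ (λ i → w i * x i) h)

  ·-update : ∀ {n} (w x d : Vector n) h {y : Vector n} → (∀ i → y i ≈ (x i + d i * h)) →
             (w · y) ≈ ((w · x) + (w · d) * h)
  ·-update w x d h y≈ = trans (·-cong w y≈) (trans (·-+ w x _) (+-congˡ (·-*ʳ w d h)))

  ·-affine : ∀ {n} (w b x : Vector n) h {y : Vector n} → (∀ i → y i ≈ ((b i + x i) * h)) →
             (w · y) ≈ (((w · b) + (w · x)) * h)
  ·-affine w b x h y≈ = trans (·-cong w y≈) (trans (·-*ʳ w _ h) (*-congʳ (·-+ w b x)))

  ind : ∀ {A : Set} → Dec A → Carrier → Carrier
  ind (yes _) v = v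
  ind (no _)  _ = 0#

  indicator : ∀ {n m} → (Fin n → Fin m) → Fin m → Vector n
  indicator p s i = ind (p i ≟ s) 1#

  classSum≈indicator· : ∀ {n m} (p : Fin n → Fin m) x s → classSum p x s ≈ (indicator p s · x)
  classSum≈indicator· {zero}  p x s = refl
  classSum≈indicator· {suc n} p x s with p fzero ≟ s
  ... | yes _ = +-cong (sym (*-identityˡ _)) (classSum≈indicator· (p ∘ fsuc) (x ∘ fsuc) s)
  ... | no  _ = +-cong (sym (zeroˡ _))       (classSum≈indicator· (p ∘ fsuc) (x ∘ fsuc) s)

  indicator-sameClass : ∀ {n m} (p : Fin n → Fin m) s {i j} → p i ≡ p j → indicator p s i ≡ indicator p s j
  indicator-sameClass p s p≡ = P.cong (λ q → ind (q ≟ s) 1#) p≡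

  IsInteger-classSum : ∀ {n m} (p : Fin n → Fin m) x s → (∀ i → IsInteger (x i)) →
                       IsInteger (classSum p x s)
  IsInteger-classSum p x s x∈ℤ = IsInteger-resp (sym (classSum≈indicator· p x s))
    (IsInteger-sumD _ (λ i → IsInteger-* (IsInteger-ind (p i ≟ s)) (x∈ℤ i)))
    where
    IsInteger-ind : ∀ {A : Set} (d : Dec A) → IsInteger (ind d 1#)
    IsInteger-ind (yes _) = IsInteger-1
    IsInteger-ind (no _)  = IsInteger-0

  unit : ∀ {n} → Fin n → Vector n
  unit = indicator id

  unit-same : ∀ {n} (i : Fin n) → unit i i ≈ 1#
  unit-same i with i ≟ i
  ... | yes _  = refl
  ... | no i≢i = ⊥-elim (i≢i P.refl)

  unit-other : ∀ {n} {i k : Fin n} → k ≢ i → unit i k ≈ 0#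
  unit-other {i = i} {k} k≢i with k ≟ i
  ... | yes k≡i = ⊥-elim (k≢i k≡i)
  ... | no _    = refl

  ·-unit : ∀ {n} (w : Vector n) i → (w · unit i) ≈ w i
  ·-unit w i = trans (sumD-single _ i (λ k k≢i → trans (*-congˡ (unit-other k≢i)) (zeroʳ _)))
                     (trans (*-congˡ (unit-same i)) (*-identityʳ _))

  record NoWorse {n m} (p : Fin n → Fin m) (c y x : Vector n) : Set (ℓ ⊔ ℓ₂) where
    constructor _,_
    field
      classSums : ∀ s → classSum p y s ≈ classSum p x s
      cost      : (c · y) ≤ (c · x)

  NoWorse-refl : ∀ {n m} {p : Fin n → Fin m} {c x} → NoWorse p c x x
  NoWorse-refl = (λ _ → refl) , ≤.reflexive refl

  NoWorse-trans : ∀ {n m} {p : Fin n → Fin m} {c x y z} → NoWorse p c x y → NoWorse p c y z → NoWorse p c x z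
  NoWorse-trans (x≈y , x≤y) (y≈z , y≤z) = (λ s → trans (x≈y s) (y≈z s)) , ≤.trans x≤y y≤z

  NoWorse-update : ∀ {n m} (p : Fin n → Fin m) c x d h {y} → (∀ i → y i ≈ (x i + d i * h)) →
                   (∀ s → classSum p d s ≈ 0#) → (c · d) ≤ 0# → 0# ≤ h → NoWorse p c y x
  NoWorse-update p c x d h {y} y≈ d-balanced cd≤0 0≤h = sums , cost
    where
    sums : ∀ s → classSum p y s ≈ classSum p x s
    sums s = begin
      classSum p y s           ≈⟨ classSum≈indicator· p y s ⟩
      χ · y                    ≈⟨ ·-update χ x d h y≈ ⟩
      (χ · x) + (χ · d) * h    ≈⟨ +-congˡ (*-congʳ (trans (sym (classSum≈indicator· p d s)) (d-balanced s))) ⟩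
      (χ · x) + 0# * h         ≈⟨ trans (+-congˡ (zeroˡ h)) (+-identityʳ _) ⟩
      χ · x                    ≈⟨ sym (classSum≈indicator· p x s) ⟩
      classSum p x s           ∎
      where χ = indicator p s
    cost : (c · y) ≤ (c · x)
    cost = ≤-respˡʳ-≈ (sym (·-update c x d h y≈)) (+-identityʳ _)
             (+-monoʳ-≤ (c · x) (≤-respˡʳ-≈ refl (zeroˡ h) (*-monoʳ-≤ h 0≤h cd≤0)))

  NoWorse-affine : ∀ {n m} (p : Fin n → Fin m) c b h {u t y x} →
                   (∀ i → y i ≈ ((b i + u i) * h)) → (∀ i → x i ≈ ((b i + t i) * h)) → 0# ≤ h →
                   NoWorse p c u t → NoWorse p c y x
  NoWorse-affine p c b h {u} {t} {y} {x} y≈ x≈ 0≤h (u≈t , u≤t) = sums , cost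
    where
    sums : ∀ s → classSum p y s ≈ classSum p x s
    sums s = begin
      classSum p y s               ≈⟨ classSum≈indicator· p y s ⟩
      χ · y                        ≈⟨ ·-affine χ b u h y≈ ⟩
      ((χ · b) + (χ · u)) * h      ≈⟨ *-congʳ (+-congˡ χ·u≈χ·t) ⟩
      ((χ · b) + (χ · t)) * h      ≈⟨ sym (·-affine χ b t h x≈) ⟩
      χ · x                        ≈⟨ sym (classSum≈indicator· p x s) ⟩
      classSum p x s               ∎
      where
      χ = indicator p s
      χ·u≈χ·t : (χ · u) ≈ (χ · t)
      χ·u≈χ·t = trans (sym (classSum≈indicator· p u s)) (trans (u≈t s) (classSum≈indicator· p t s))
    cost : (c · y) ≤ (c · x)
    cost = ≤-respˡʳ-≈ (sym (·-affine c b u h y≈)) (sym (·-affine c b t h x≈))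
             (*-monoʳ-≤ h 0≤h (+-monoʳ-≤ (c · b) u≤t))

  module Pairing {n m} {p : Fin n → Fin m} {k x partner σ ν}
                 (matching : IsMatching p k x partner) (orientation : IsOrientation k x partner σ)
                 (isNu : IsNu k x σ ν) where

    InS? : ∀ i → Dec (InS k x i)
    InS? i = ¬? (IsInteger? (pow two k * x i))

    pairBy : ∀ i → Dec (InS k x i) → Fin n
    pairBy i (yes _) = partner i
    pairBy i (no _)  = i

    pair : Fin n → Fin n
    pair i = pairBy i (InS? i)

    pair-involutive : ∀ i → pair (pair i) ≡ i
    pair-involutive i with InS? i
    ... | no i∉S with InS? i
    ...   | yes i∈S = ⊥-elim (i∉S i∈S)
    ...   | no _    = P.refl
    pair-involutive i | yes i∈S with matching i i∈S
    ... | partner∈S , _ , partner-involutive , _ with InS? (partner i)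
    ...   | yes _          = partner-involutive
    ...   | no  partner∉S = ⊥-elim (partner∉S partner∈S)

    pair-sameClass : ∀ i → p (pair i) ≡ p i
    pair-sameClass i with InS? i
    ... | yes i∈S = proj₂ (proj₂ (proj₂ (matching i i∈S)))
    ... | no  _   = P.refl

    ν-pair : ∀ i → ν (pair i) ≈ - ν i
    ν-pair i with InS? i
    ... | no i∉S = trans ν≈0 (trans (sym -0#≈0#) (-‿cong (sym ν≈0)))
      where ν≈0 = proj₂ (proj₂ (isNu i)) i∉S
    ... | yes i∈S with σ i in σi≡ | proj₁ (matching i i∈S)
    ...   | true  | partner∈S =
      trans (proj₁ (proj₂ (isNu (partner i))) partner∈S (P.trans (orientation i i∈S) (P.cong not σi≡)))
            (-‿cong (sym (proj₁ (isNu i) i∈S σi≡)))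
    ...   | false | partner∈S =
      trans (proj₁ (isNu (partner i)) partner∈S (P.trans (orientation i i∈S) (P.cong not σi≡)))
            (trans (sym (-‿involutive half)) (-‿cong (sym (proj₁ (proj₂ (isNu i)) i∈S σi≡))))

    indicator·ν≈0 : ∀ s → (indicator p s · ν) ≈ 0#
    indicator·ν≈0 s = sumD-antisymmetric _ pair pair-involutive λ i →
      trans (*-cong (reflexive (indicator-sameClass p s (pair-sameClass i))) (ν-pair i)) (sym (-‿distribʳ-* _ _))

  step-noWorse : ∀ {n m} (p : Fin n → Fin m) c k {x y} → Step p c k x y → NoWorse p c y x
  step-noWorse p c k {x} (_ , _ , ν , ν′ , matching , orientation , isNu , ν′≈±ν , c·ν′≤0 , y≈) =
    NoWorse-update p c x ν′ (invPow2 k) y≈ classSum-ν′≈0 c·ν′≤0 (0≤invPow2 k)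
    where
    open Pairing {k = k} matching orientation isNu
    indicator·ν′≈0 : ((∀ i → ν′ i ≈ ν i) ⊎ (∀ i → ν′ i ≈ - ν i)) → ∀ s → (indicator p s · ν′) ≈ 0#
    indicator·ν′≈0 (inj₁ ν′≈ν)  s = trans (·-cong _ ν′≈ν) (indicator·ν≈0 s)
    indicator·ν′≈0 (inj₂ ν′≈-ν) s =
      trans (·-cong _ ν′≈-ν) (trans (·-neg _ ν) (trans (-‿cong (indicator·ν≈0 s)) -0#≈0#))
    classSum-ν′≈0 : ∀ s → classSum p ν′ s ≈ 0#
    classSum-ν′≈0 s = trans (classSum≈indicator· p ν′ s) (indicator·ν′≈0 ν′≈±ν s)

  indicator-self : ∀ {n m} (p : Fin n → Fin m) i → indicator p (p i) i ≈ 1#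
  indicator-self p i with p i ≟ p i
  ... | yes _    = refl
  ... | no pi≢pi = ⊥-elim (pi≢pi P.refl)

  module Rounding {n m} (p : Fin n → Fin m) (c g : Vector n) (g-0or1 : ∀ i → (g i ≈ 0#) ⊎ (g i ≈ 1#)) where

    InBox : Vector n → Set ℓ₂
    InBox t = ∀ i → (0# ≤ t i) × (t i ≤ g i)

    IsVertex : Vector n → Set ℓ
    IsVertex u = ∀ i → (u i ≈ 0#) ⊎ (u i ≈ g i)

    IntegralClassSums : Vector n → Set ℓ
    IntegralClassSums t = ∀ s → IsInteger (classSum p t s)

    integral⇒vertex : ∀ {t} → InBox t → (∀ i → IsInteger (t i)) → IsVertex t
    integral⇒vertex {t} box t∈ℤ i with g-0or1 i
    ... | inj₁ gi≈0 = inj₁ (≤.antisym (≤-respˡʳ-≈ refl gi≈0 (proj₂ (box i))) (proj₁ (box i)))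
    ... | inj₂ gi≈1 with IsInteger-0≤x≤1 (t∈ℤ i) (proj₁ (box i)) (≤-respˡʳ-≈ refl gi≈1 (proj₂ (box i)))
    ...   | inj₁ ti≈0 = inj₁ ti≈0
    ...   | inj₂ ti≈1 = inj₂ (trans ti≈1 (sym gi≈1))

    nonIntegral? : (t : Vector n) (i : Fin n) → Dec (¬ IsInteger (t i))
    nonIntegral? t i = ¬? (IsInteger? (t i))

    NonIntegral : Vector n → Subset n
    NonIntegral t = tabulate (does ∘ nonIntegral? t)

    ∈-NonIntegral⁺ : ∀ t {i} → ¬ IsInteger (t i) → i ∈ NonIntegral t
    ∈-NonIntegral⁺ t {i} ti∉ℤ =
      lookup⇒[]= i _ (P.trans (lookup∘tabulate _ i) (dec-true (nonIntegral? t i) ti∉ℤ))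

    ∈-NonIntegral⁻ : ∀ t {i} → i ∈ NonIntegral t → ¬ IsInteger (t i)
    ∈-NonIntegral⁻ t {i} i∈ ti∈ℤ
      with P.trans (P.sym ([]=⇒lookup i∈))
             (P.trans (lookup∘tabulate _ i) (dec-false (nonIntegral? t i) (λ ti∉ℤ → ti∉ℤ ti∈ℤ)))
    ... | ()

    nonIntegral-partner : ∀ t → IntegralClassSums t → ∀ {i} → ¬ IsInteger (t i) →
                          ∃[ j ] (j ≢ i × p j ≡ p i × ¬ IsInteger (t j))
    nonIntegral-partner t sums∈ℤ {i} ti∉ℤ
      with any? (λ j → ¬? (j ≟ i) ×-dec (p j ≟ p i) ×-dec nonIntegral? t j)
    ... | yes partner = partner
    ... | no  none    = ⊥-elim (ti∉ℤ ti∈ℤ)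
      where
      others : ∀ k → k ≢ i → IsInteger (indicator p (p i) k * t k)
      others k k≢i with p k ≟ p i | IsInteger? (t k)
      ... | no  _   | _       = IsInteger-resp (sym (zeroˡ (t k))) IsInteger-0
      ... | yes _   | yes tk∈ℤ = IsInteger-resp (sym (*-identityˡ (t k))) tk∈ℤ
      ... | yes pk≡ | no tk∉ℤ  = ⊥-elim (none (k , k≢i , pk≡ , tk∉ℤ))
      χ·t∈ℤ : IsInteger (indicator p (p i) · t)
      χ·t∈ℤ = IsInteger-resp (classSum≈indicator· p t (p i)) (sums∈ℤ (p i))
      ti∈ℤ : IsInteger (t i)
      ti∈ℤ = IsInteger-resp (trans (*-congʳ (indicator-self p i)) (*-identityˡ (t i)))
                            (IsInteger-sumD⁻ _ i others χ·t∈ℤ)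

    transfer : Vector n → Fin n → Fin n → Carrier → Vector n
    transfer t i j δ k = t k + (unit i k - unit j k) * δ

    transfer-at-i : ∀ t {i j} δ → i ≢ j → transfer t i j δ i ≈ (t i + δ)
    transfer-at-i t {i} {j} δ i≢j = +-congˡ (begin
      (unit i i - unit j i) * δ  ≈⟨ *-congʳ (+-cong (unit-same i) (-‿cong (unit-other i≢j))) ⟩
      (1# - 0#) * δ              ≈⟨ *-congʳ (trans (+-congˡ -0#≈0#) (+-identityʳ 1#)) ⟩
      1# * δ                     ≈⟨ *-identityˡ δ ⟩
      δ                          ∎)

    transfer-at-j : ∀ t {i j} δ → j ≢ i → transfer t i j δ j ≈ (t j - δ)
    transfer-at-j t {i} {j} δ j≢i = +-congˡ (begin
      (unit i j - unit j j) * δ  ≈⟨ *-congʳ (+-cong (unit-other j≢i) (-‿cong (unit-same j))) ⟩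
      (0# - 1#) * δ              ≈⟨ *-congʳ (+-identityˡ (- 1#)) ⟩
      - 1# * δ                   ≈⟨ sym (-‿distribˡ-* 1# δ) ⟩
      - (1# * δ)                 ≈⟨ -‿cong (*-identityˡ δ) ⟩
      - δ                        ∎)

    transfer-elsewhere : ∀ t {i j} δ {k} → k ≢ i → k ≢ j → transfer t i j δ k ≈ t k
    transfer-elsewhere t {i} {j} δ {k} k≢i k≢j = trans (+-congˡ (begin
      (unit i k - unit j k) * δ  ≈⟨ *-congʳ (+-cong (unit-other k≢i) (-‿cong (unit-other k≢j))) ⟩
      (0# - 0#) * δ              ≈⟨ *-congʳ (-‿inverseʳ 0#) ⟩
      0# * δ                     ≈⟨ zeroˡ δ ⟩
      0#                         ∎)) (+-identityʳ (t k))

    transfer-noWorse : ∀ t {i j} δ → p i ≡ p j → c i ≤ c j → 0# ≤ δ → NoWorse p c (transfer t i j δ) t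
    transfer-noWorse t {i} {j} δ pi≡pj ci≤cj 0≤δ =
      NoWorse-update p c t (λ k → unit i k - unit j k) δ (λ _ → refl) balanced c·d≤0 0≤δ
      where
      ·-unit-difference : ∀ w → (w · (λ k → unit i k - unit j k)) ≈ (w i - w j)
      ·-unit-difference w =
        trans (·-+ w (unit i) _) (+-cong (·-unit w i) (trans (·-neg w (unit j)) (-‿cong (·-unit w j))))
      balanced : ∀ s → classSum p (λ k → unit i k - unit j k) s ≈ 0#
      balanced s = trans (classSum≈indicator· p _ s) (trans (·-unit-difference (indicator p s))
                     (trans (+-congʳ (reflexive (indicator-sameClass p s pi≡pj))) (-‿inverseʳ _)))
      c·d≤0 : (c · (λ k → unit i k - unit j k)) ≤ 0#
      c·d≤0 = ≤-respˡʳ-≈ (sym (·-unit-difference c)) (-‿inverseʳ (c j)) (+-monoˡ-≤ (- c j) ci≤cj)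

    record Improvement (t : Vector n) : Set (a ⊔ ℓ ⊔ ℓ₂) where
      field
        next    : Vector n
        inBox   : InBox next
        noWorse : NoWorse p c next t
        fewer   : NonIntegral next ⊂ NonIntegral t

    NonIntegral-⊆ : ∀ t t′ {i j} → (∀ k → k ≢ i → k ≢ j → t′ k ≈ t k) →
                    ¬ IsInteger (t i) → ¬ IsInteger (t j) → NonIntegral t′ ⊆ NonIntegral t
    NonIntegral-⊆ t t′ {i} {j} t′≈t ti∉ℤ tj∉ℤ {k} k∈ with k ≟ i | k ≟ j
    ... | yes P.refl | _          = ∈-NonIntegral⁺ t ti∉ℤ
    ... | no _       | yes P.refl = ∈-NonIntegral⁺ t tj∉ℤ
    ... | no k≢i     | no k≢j     =
      ∈-NonIntegral⁺ t (λ tk∈ℤ → ∈-NonIntegral⁻ t′ k∈ (IsInteger-resp (sym (t′≈t k k≢i k≢j)) tk∈ℤ))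

    g-integer : ∀ i → IsInteger (g i)
    g-integer i with g-0or1 i
    ... | inj₁ gi≈0 = IsInteger-resp (sym gi≈0) IsInteger-0
    ... | inj₂ gi≈1 = IsInteger-resp (sym gi≈1) IsInteger-1

    module Exchange {t i j} (box : InBox t) (i≢j : i ≢ j) (pi≡pj : p i ≡ p j) (ci≤cj : c i ≤ c j)
                    (ti∉ℤ : ¬ IsInteger (t i)) (tj∉ℤ : ¬ IsInteger (t j)) where

      transfer-inBox : ∀ δ → 0# ≤ δ → δ ≤ (g i - t i) → δ ≤ t j → InBox (transfer t i j δ)
      transfer-inBox δ 0≤δ δ≤gi-ti δ≤tj k = byCases k (k ≟ i) (k ≟ j)
        where
        byCases : ∀ k → Dec (k ≡ i) → Dec (k ≡ j) → (0# ≤ transfer t i j δ k) × (transfer t i j δ k ≤ g k)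
        byCases k (yes P.refl) _ =
          ≤-respˡʳ-≈ (+-identityʳ 0#) (sym (transfer-at-i t δ i≢j)) (+-mono-≤ (proj₁ (box i)) 0≤δ) ,
          ≤-respˡʳ-≈ (sym (transfer-at-i t δ i≢j)) (solve 2 (λ t g → t :+ (g :- t) := g) refl (t i) (g i))
                     (+-monoʳ-≤ (t i) δ≤gi-ti)
        byCases k (no k≢i) (yes P.refl) =
          ≤-respˡʳ-≈ refl (sym (transfer-at-j t δ k≢i)) (x≤y⇒0≤y-x δ≤tj) ,
          ≤-respˡʳ-≈ (sym (transfer-at-j t δ k≢i)) refl
                     (≤.trans (≤-respˡʳ-≈ refl (trans (+-congˡ -0#≈0#) (+-identityʳ (t j)))
                                         (+-monoʳ-≤ (t j) (neg-antimono-≤ 0≤δ)))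
                              (proj₂ (box j)))
        byCases k (no k≢i) (no k≢j) =
          ≤-respˡʳ-≈ refl (sym (transfer-elsewhere t δ k≢i k≢j)) (proj₁ (box k)) ,
          ≤-respˡʳ-≈ (sym (transfer-elsewhere t δ k≢i k≢j)) refl (proj₂ (box k))

      improvement-by : ∀ δ → 0# ≤ δ → δ ≤ (g i - t i) → δ ≤ t j →
                       ∃[ k ] (k ∈ NonIntegral t × IsInteger (transfer t i j δ k)) → Improvement t
      improvement-by δ 0≤δ δ≤gi-ti δ≤tj (k , k∈ , t′k∈ℤ) = record
        { next    = transfer t i j δ
        ; inBox   = transfer-inBox δ 0≤δ δ≤gi-ti δ≤tj
        ; noWorse = transfer-noWorse t δ pi≡pj ci≤cj 0≤δ
        ; fewer   = NonIntegral-⊆ t _ (λ _ → transfer-elsewhere t δ) ti∉ℤ tj∉ℤ ,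
                    k , k∈ , λ k∈′ → ∈-NonIntegral⁻ _ k∈′ t′k∈ℤ
        }

      -- δ = min (g i - t i) (t j) makes t i or t j integral.
      improvement : Improvement t
      improvement with ≤.total (g i - t i) (t j)
      ... | inj₁ gi-ti≤tj = improvement-by (g i - t i) (x≤y⇒0≤y-x (proj₂ (box i))) (≤.reflexive refl) gi-ti≤tj
        (i , ∈-NonIntegral⁺ t ti∉ℤ ,
         IsInteger-resp (sym (trans (transfer-at-i t _ i≢j) (solve 2 (λ t g → t :+ (g :- t) := g) refl (t i) (g i))))
                        (g-integer i))
      ... | inj₂ tj≤gi-ti = improvement-by (t j) (proj₁ (box j)) tj≤gi-ti (≤.reflexive refl)
        (j , ∈-NonIntegral⁺ t tj∉ℤ ,
         IsInteger-resp (sym (trans (transfer-at-j t _ (i≢j ∘ P.sym)) (-‿inverseʳ (t j)))) IsInteger-0)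

    exchange : ∀ {t i j} → InBox t → i ≢ j → p i ≡ p j → ¬ IsInteger (t i) → ¬ IsInteger (t j) → Improvement t
    exchange {t} {i} {j} box i≢j pi≡pj ti∉ℤ tj∉ℤ with ≤.total (c i) (c j)
    ... | inj₁ ci≤cj = Exchange.improvement box i≢j pi≡pj ci≤cj ti∉ℤ tj∉ℤ
    ... | inj₂ cj≤ci = Exchange.improvement box (i≢j ∘ P.sym) (P.sym pi≡pj) cj≤ci tj∉ℤ ti∉ℤ

    round : ∀ t → Acc _⊂_ (NonIntegral t) → InBox t → IntegralClassSums t →
            Σ[ u ∈ Vector n ] (IsVertex u × NoWorse p c u t)
    round t (acc smaller) box sums∈ℤ with any? (nonIntegral? t)
    ... | no allIntegral =
      t , integral⇒vertex box (λ i → decidable-stable (IsInteger? (t i)) (λ ti∉ℤ → allIntegral (i , ti∉ℤ))) ,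
      NoWorse-refl
    ... | yes (i , ti∉ℤ) with nonIntegral-partner t sums∈ℤ ti∉ℤ
    ...   | j , j≢i , pj≡pi , tj∉ℤ with exchange box j≢i pj≡pi tj∉ℤ ti∉ℤ
    ...     | record { next = t′ ; inBox = box′ ; noWorse = t′≼t ; fewer = fewer } with
              round t′ (smaller fewer) box′ (λ s → IsInteger-resp (sym (NoWorse.classSums t′≼t s)) (sums∈ℤ s))
    ...       | u , vertex , u≼t′ = u , vertex , NoWorse-trans u≼t′ t′≼t

  module InitialPoint {n m} (p : Fin n → Fin m) (c lam : Vector n) (K : ℕ)
                      (sums∈ℤ : ∀ s → IsInteger (classSum p lam s)) where

    scaled base : Vector n
    scaled i = pow two K * lam i
    base   i = fromℤ ⌊ scaled i ⌋

    open Rounding p c (ceilGap ∘ scaled) (ceilGap-0or1 ∘ scaled)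

    scaled-classSum : ∀ s → classSum p scaled s ≈ (classSum p lam s * pow two K)
    scaled-classSum s = begin
      classSum p scaled s            ≈⟨ classSum≈indicator· p scaled s ⟩
      χ · scaled                     ≈⟨ ·-cong χ (λ i → *-comm (pow two K) (lam i)) ⟩
      χ · (λ i → lam i * pow two K)  ≈⟨ ·-*ʳ χ lam (pow two K) ⟩
      (χ · lam) * pow two K          ≈⟨ *-congʳ (sym (classSum≈indicator· p lam s)) ⟩
      classSum p lam s * pow two K   ∎
      where χ = indicator p s

    frac-classSum : ∀ s → classSum p (frac ∘ scaled) s ≈ (classSum p scaled s - classSum p base s)
    frac-classSum s = begin
      classSum p (frac ∘ scaled) s              ≈⟨ classSum≈indicator· p _ s ⟩
      χ · (λ i → scaled i + - base i)           ≈⟨ ·-+ χ scaled _ ⟩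
      (χ · scaled) + (χ · (λ i → - base i))     ≈⟨ +-congˡ (·-neg χ base) ⟩
      (χ · scaled) - (χ · base)                 ≈⟨ sym (+-cong (classSum≈indicator· p scaled s)
                                                               (-‿cong (classSum≈indicator· p base s))) ⟩
      classSum p scaled s - classSum p base s   ∎
      where χ = indicator p s

    frac-integralClassSums : IntegralClassSums (frac ∘ scaled)
    frac-integralClassSums s = IsInteger-resp (sym (frac-classSum s))
      (IsInteger-+ (IsInteger-resp (sym (scaled-classSum s)) (IsInteger-* (sums∈ℤ s) (IsInteger-pow2 K)))
                   (IsInteger-neg (IsInteger-classSum p base s (λ i → ⌊ scaled i ⌋ , refl))))

    unscale : Vector n → Vector n
    unscale u i = (base i + u i) * invPow2 K

    lam≈unscale-frac : ∀ i → lam i ≈ unscale (frac ∘ scaled) i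
    lam≈unscale-frac i = sym (begin
      (base i + (pow two K * lam i - base i)) * invPow2 K
        ≈⟨ solve 4 (λ b t l h → (b :+ (t :* l :- b)) :* h := l :* (t :* h))
                   refl (base i) (pow two K) (lam i) (invPow2 K) ⟩
      lam i * (pow two K * invPow2 K)  ≈⟨ *-congˡ (pow2*invPow2 K) ⟩
      lam i * 1#                       ≈⟨ *-identityʳ (lam i) ⟩
      lam i                            ∎)

    unscale-vertex : Σ[ u ∈ Vector n ] (IsVertex u × NoWorse p c u (frac ∘ scaled)) →
                     Σ[ μ ∈ Vector n ] (Feasible p lam K μ × NoWorse p c μ lam)
    unscale-vertex (u , vertex , u≼frac) = unscale u , (onGrid , NoWorse.classSums unscale-u≼lam) , unscale-u≼lam
      where
      unscale-u≼lam : NoWorse p c (unscale u) lam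
      unscale-u≼lam = NoWorse-affine p c base (invPow2 K) (λ _ → refl) lam≈unscale-frac (0≤invPow2 K) u≼frac
      onGrid : ∀ i → (unscale u i ≈ (fromℤ ⌊ scaled i ⌋ * invPow2 K))
                   ⊎ (unscale u i ≈ (fromℤ ⌈ scaled i ⌉ * invPow2 K))
      onGrid i with vertex i
      ... | inj₁ ui≈0   = inj₁ (*-congʳ (trans (+-congˡ ui≈0) (+-identityʳ (base i))))
      ... | inj₂ ui≈gap = inj₂ (*-congʳ (trans (+-congˡ ui≈gap)
                                  (solve 2 (λ b c → b :+ (c :- b) := c) refl (base i) (fromℤ ⌈ scaled i ⌉))))

    feasible-noWorse : Σ[ μ ∈ Vector n ] (Feasible p lam K μ × NoWorse p c μ lam)
    feasible-noWorse = unscale-vertex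
      (round (frac ∘ scaled) (⊂-wellFounded _) (λ i → 0≤frac (scaled i) , frac≤ceilGap (scaled i))
             frac-integralClassSums)

  IsInitial-noWorse : ∀ {n m} {p : Fin n → Fin m} {lam} K {c μ₀} → IsInitial p lam K c μ₀ →
                      Σ[ μ ∈ Vector n ] (Feasible p lam K μ × NoWorse p c μ lam) → NoWorse p c μ₀ lam
  IsInitial-noWorse K (feasible₀ , minimal) (μ , feasible , μ≼lam) =
    proj₂ feasible₀ , ≤.trans (minimal μ feasible) (NoWorse.cost μ≼lam)

  module _ {n m} {p : Fin n → Fin m} {lam : Vector n} {K} {c} (E : Execution p lam K c) where
    open Execution E

    iterate-noWorse : ∀ k → k ℕ.≤ K → NoWorse p c (iterate 0) (iterate k)
    iterate-noWorse zero    _   = NoWorse-refl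
    iterate-noWorse (suc k) k<K = NoWorse-trans (iterate-noWorse k (ℕP.<⇒≤ k<K)) (step-noWorse p c k (step k k<K))

    output-noWorse : (∀ s → IsInteger (classSum p lam s)) → NoWorse p c output lam
    output-noWorse sums∈ℤ = NoWorse-trans (iterate-noWorse K ℕP.≤-refl)
      (IsInitial-noWorse K initial (InitialPoint.feasible-noWorse p c lam K sums∈ℤ))

claim1 : ∀ {a ℓ ℓ₂ : Level} (F : OrderedFloorRing a ℓ ℓ₂) →
    let open OrderedFloorRing F
        open SRR F
    in (n m : ℕ) (p : Fin n → Fin m) (lam : Vector n) →
       (∀ i → (0# ≤ lam i) × (lam i ≤ 1#)) →
       (∀ s → IsInteger (classSum p lam s)) →
       (K : ℕ) → 1 ℕ.≤ K → (c : Vector n) →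
       (E : Execution p lam K c) →
       (∀ s → classSum p (Execution.output E) s ≈ classSum p lam s)
       × ((c · Execution.output E) ≤ (c · lam))
claim1 F n m p lam _ sums∈ℤ K _ c E = classSums , cost
  where
  open SemiRandomRoundingProperties F
  open NoWorse (output-noWorse E sums∈ℤ)
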